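{- Let $t'$ be a rooted tree whose leaves are labelled by a finite set $X$, and let $A\subseteq X$ be nonempty. Define counters on the vertices of $t'$ by: for a leaf $v$, $counter(v)=1$ if $v\in A$ and $counter(v)=0$ otherwise; for an internal vertex $v$, \[ counter(v)=\sum_{w\in child(v)} \begin{cases} counter(w) & \text{if } counter(w)=|L_{t'}(w)|,\\ 0 & \text{otherwise.}\end{cases} \] Let $z'$ be the least common ancestor in $t'$ of the leaves in $A$. Then $A$ is compatible with $t'$ if and only if $counter(z')=|A|$.
   Context: For a vertex $v$ of a rooted tree $t'$, $child(v)$ denotes its set of children and $L_{t'}(v)$ the set of leaves in the subtree rooted at $v$. A leaf set $A$ is compatible with $t'$ if there is a vertex $w$ of $t'$ with $A\subseteq L_{t'}(w)$ such that for every child $v$ of $w$, either $L_{t'}(v)\cap A=\emptyset$ or $L_{t'}(v)\subseteq A$ (equivalently, the bipartition $A\,|\,X\setminus A$ can be added to $t'$ by refining it). The counters above are exactly those maintained by the algorithm after all leaves of $A$ have been added starting from all-zero counters. -}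

module Defs where

open import Data.Nat using (ℕ; zero; suc; _+_; _≟_)
open import Data.Fin using (Fin)
open import Data.Fin.Subset using (Subset; _∈_; _∉_)
open import Data.Fin.Subset.Properties using (_∈?_)
open import Data.List using (List; []; _∷_; _++_; length)
open import Data.List.Relation.Unary.Unique.Propositional using (Unique)
import Data.List.Membership.Propositional as ListMem
open import Data.Product using (Σ; ∃; _×_)
open import Data.Sum using (_⊎_)
open import Relation.Nullary using (yes; no)
open import Data.Unit using () renaming (⊤ to ⊤')
open import Data.Empty using () renaming (⊥ to ⊥')

-- Rooted trees whose leaves carry labels in X = Fin n.
-- An internal vertex is a 'node' with its (ordered) list of children.
data Tree (n : ℕ) : Set where
  leaf : Fin n → Tree n
  node : List (Tree n) → Tree n

module _ {n : ℕ} where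

  open ListMem using () renaming (_∈_ to _∈ₗ_)

  children : Tree n → List (Tree n)
  children (leaf _) = []
  children (node ts) = ts

  mutual
    leaves : Tree n → List (Fin n)
    leaves (leaf x) = x ∷ []
    leaves (node ts) = leavesL ts

    leavesL : List (Tree n) → List (Fin n)
    leavesL [] = []
    leavesL (t ∷ ts) = leaves t ++ leavesL ts

  mutual
    Proper : Tree n → Set
    Proper (leaf _) = ⊤'
    Proper (node []) = ⊥'
    Proper (node (t ∷ ts)) = Proper t × ProperL ts

    ProperL : List (Tree n) → Set
    ProperL [] = ⊤'
    ProperL (t ∷ ts) = Proper t × ProperL ts

  LeafLabelled : Tree n → Set
  LeafLabelled t = Proper t × Unique (leaves t) × (∀ (x : Fin n) → x ∈ₗ leaves t)

  -- vertices of a tree, as positions (paths from the root)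
  data Pos : Tree n → Set where
    here : ∀ {t} → Pos t
    down : ∀ {ts c} → c ∈ₗ ts → Pos c → Pos (node ts)

  subtreeAt : ∀ {t} → Pos t → Tree n
  subtreeAt {t} here = t
  subtreeAt (down _ p) = subtreeAt p

  -- p ≼ q : vertex p is a descendant of (or equal to) vertex q
  data _≼_ : ∀ {t} → Pos t → Pos t → Set where
    root : ∀ {t} {p : Pos t} → p ≼ here
    step : ∀ {ts c} {m : c ∈ₗ ts} {p q : Pos c} → p ≼ q → down m p ≼ down m q

  _⊆L_ : Subset n → Tree n → Set
  A ⊆L v = ∀ x → x ∈ A → x ∈ₗ leaves v

  IsLCA : (A : Subset n) → ∀ {t} → Pos t → Set
  IsLCA A {t} z = (A ⊆L subtreeAt z) × (∀ (w : Pos t) → A ⊆L subtreeAt w → z ≼ w)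

  Compatible : Subset n → Tree n → Set
  Compatible A t = Σ (Pos t) λ w → (A ⊆L subtreeAt w) ×
    (∀ v → v ∈ₗ children (subtreeAt w) →
       (∀ x → x ∈ₗ leaves v → x ∉ A) ⊎ (∀ x → x ∈ₗ leaves v → x ∈ A))

  mutual
    counter : Subset n → Tree n → ℕ
    counter A (leaf x) with x ∈? A
    ... | yes _ = 1
    ... | no _ = 0
    counter A (node ts) = counterL A ts

    counterL : Subset n → List (Tree n) → ℕ
    counterL A [] = 0
    counterL A (w ∷ ws) with counter A w ≟ length (leaves w)
    ... | yes _ = counter A w + counterL A ws
    ... | no _ = counterL A ws

module Submission where

-- For a vertex v let count(v) be the number of leaves of v that lie
-- in A.  Each child w of an internal vertex contributes counter(w) to its
-- parent's counter if w is "full" (counter(w) = |L(w)|) and 0 otherwise, and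
-- one shows by induction that
--   (1) counter(v) ≤ count(v), and w is full exactly when L(w) ⊆ A;
--   (2) hence the contribution of w is at most count(w), with equality exactly
--       when w is monochromatic (L(w) ⊆ A or L(w) ∩ A = ∅);
--   (3) so counter(v) = count(v) iff all children of v are monochromatic,
--       since a sum of termwise smaller numbers is equal only if every term is.
-- Because the leaf labels are distinct and A ⊆ L(z'), count(z') = |A|.  Finally,
-- all children of z' are monochromatic iff A is compatible: one direction takes
-- w = z'; conversely the witness w is an ancestor of z', and if w ≠ z' then the
-- child of w above z' meets A, so it is full, so z' and all its children are.

open import Defs
open import Data.Nat using (ℕ)
open import Data.Fin.Subset using (Subset; Nonempty; ∣_∣)
open import Relation.Binary.PropositionalEquality using (_≡_)
open import Function.Bundles using (_⇔_)

open import Data.Nat using (suc; _+_; _≤_; z≤n; _≟_)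
open import Data.Nat.Properties
  using (≤-refl; ≤-trans; ≤-antisym; ≤-reflexive; +-mono-≤; +-cancelʳ-≤; +-cancelˡ-≡; <-irrefl; module ≤-Reasoning)
open import Data.Fin using (Fin; zero; suc)
open import Data.Fin.Subset using (_∈_; _∉_; _-_; inside; outside)
open import Data.Fin.Subset.Properties
  using (_∈?_; p─⊥≡p; p─q⊆p; x∈p∧x≢y⇒x∈p-y; Empty-unique; ∣⊥∣≡0)
open import Data.Vec.Base using (_∷_; here; there)
open import Data.List using (List; []; _∷_; _++_; length; filter; map)
open import Data.Nat.ListAction using (sum)
open import Data.List.Properties
  using (length-++; filter-++; length-filter; filter-complete; filter-all; filter-none; filter-some)
open import Data.List.Membership.Propositional using () renaming (_∈_ to _∈ₗ_; _∉_ to _∉ₗ_)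
open import Data.List.Membership.Propositional.Properties using (∈-++⁺ˡ; ∈-++⁺ʳ; ∈-filter⁻)
open import Data.List.Relation.Unary.Any as Any using ()
open import Data.List.Relation.Unary.All as All using (All; []; _∷_)
import Data.List.Relation.Unary.All.Properties as AllP
open import Data.List.Relation.Unary.Unique.Propositional using (Unique)
open import Data.List.Relation.Unary.AllPairs using ([]; _∷_)
open import Data.Product using (Σ; _×_; _,_; proj₂)
open import Data.Sum using (_⊎_; inj₁; inj₂)
open import Data.Empty using (⊥-elim)
open import Function.Base using (_∘_)
open import Function.Bundles using (mk⇔; Equivalence)
open import Relation.Nullary using (¬_; yes; no)
open import Relation.Binary.PropositionalEquality using (refl; sym; trans; cong; cong₂; subst; module ≡-Reasoning)

open Equivalence using (to; from)

module _ {a} {X : Set a} (f g : X → ℕ) where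

  sum-map-mono : ∀ {xs} → All (λ x → f x ≤ g x) xs → sum (map f xs) ≤ sum (map g xs)
  sum-map-mono [] = z≤n
  sum-map-mono (fx≤gx ∷ rest) = +-mono-≤ fx≤gx (sum-map-mono rest)

  private
    +-≡-split : ∀ {a b c d} → a ≤ b → c ≤ d → a + c ≡ b + d → a ≡ b × c ≡ d
    +-≡-split {a} {b} {c} {d} a≤b c≤d eq = a≡b , +-cancelˡ-≡ a c d (trans eq (cong (_+ d) (sym a≡b)))
      where
      b≤a : b ≤ a
      b≤a = +-cancelʳ-≤ d b a (≤-trans (≤-reflexive (sym eq)) (+-mono-≤ ≤-refl c≤d))
      a≡b : a ≡ b
      a≡b = ≤-antisym a≤b b≤a

  sum-map-≡⇔ : ∀ {xs} → All (λ x → f x ≤ g x) xs →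
    (sum (map f xs) ≡ sum (map g xs) ⇔ All (λ x → f x ≡ g x) xs)
  sum-map-≡⇔ f≤g = mk⇔ (termwise f≤g) agree⇒sum
    where
    termwise : ∀ {ys} → All (λ x → f x ≤ g x) ys → sum (map f ys) ≡ sum (map g ys) → All (λ x → f x ≡ g x) ys
    termwise [] _ = []
    termwise (fy≤gy ∷ rest) eq with +-≡-split fy≤gy (sum-map-mono rest) eq
    ... | fy≡gy , eqs = fy≡gy ∷ termwise rest eqs
    agree⇒sum : ∀ {ys} → All (λ x → f x ≡ g x) ys → sum (map f ys) ≡ sum (map g ys)
    agree⇒sum [] = refl
    agree⇒sum (fy≡gy ∷ rest) = cong₂ _+_ fy≡gy (agree⇒sum rest)

module Counting {n : ℕ} (A : Subset n) where

  count : List (Fin n) → ℕ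
  count xs = length (filter (_∈? A) xs)

  count-++ : ∀ xs ys → count (xs ++ ys) ≡ count xs + count ys
  count-++ xs ys = trans (cong length (filter-++ (_∈? A) xs ys)) (length-++ (filter (_∈? A) xs))

  count≤length : ∀ xs → count xs ≤ length xs
  count≤length = length-filter (_∈? A)

  count≡length⇔⊆ : ∀ xs → count xs ≡ length xs ⇔ (∀ x → x ∈ₗ xs → x ∈ A)
  count≡length⇔⊆ xs = mk⇔
    (λ eq x x∈xs → proj₂ (∈-filter⁻ (_∈? A) {xs = xs} (subst (x ∈ₗ_) (sym (filter-complete (_∈? A) {xs} eq)) x∈xs)))
    (λ all → cong length (filter-all (_∈? A) (All.tabulate (λ {x} → all x))))

  count≡0⇔disjoint : ∀ xs → count xs ≡ 0 ⇔ (∀ x → x ∈ₗ xs → x ∉ A)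
  count≡0⇔disjoint xs = mk⇔
    (λ eq x x∈xs x∈A → <-irrefl (sym eq) (filter-some (_∈? A) (Any.map (λ { refl → x∈A }) x∈xs)))
    (λ none → cong length (filter-none (_∈? A) (All.tabulate (λ {x} → none x))))

open Counting using (count; count-++)

∣p∣≡1+∣p-x∣ : ∀ {n} {x : Fin n} {p : Subset n} → x ∈ p → ∣ p ∣ ≡ suc ∣ p - x ∣
∣p∣≡1+∣p-x∣ {p = inside ∷ p} here = cong (suc ∘ ∣_∣) (sym (p─⊥≡p p))
∣p∣≡1+∣p-x∣ {p = inside ∷ p} (there x∈p) = cong suc (∣p∣≡1+∣p-x∣ x∈p)
∣p∣≡1+∣p-x∣ {p = outside ∷ p} (there x∈p) = ∣p∣≡1+∣p-x∣ x∈p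

x∉p-x : ∀ {n} {x : Fin n} {p : Subset n} → x ∉ p - x
x∉p-x {x = zero} {p = _ ∷ _} ()
x∉p-x {x = suc x} {p = _ ∷ _} (there x∈p-x) = x∉p-x x∈p-x

count-remove : ∀ {n} (A : Subset n) {x} xs → x ∉ₗ xs → count A xs ≡ count (A - x) xs
count-remove A [] _ = refl
count-remove A {x} (y ∷ ys) x∉y∷ys with y ∈? A | y ∈? A - x
... | yes _ | yes _ = cong suc (count-remove A ys (x∉y∷ys ∘ Any.there))
... | no _ | no _ = count-remove A ys (x∉y∷ys ∘ Any.there)
... | yes y∈A | no y∉A-x = ⊥-elim (y∉A-x (x∈p∧x≢y⇒x∈p-y y∈A (λ { refl → x∉y∷ys (Any.here refl) })))
... | no y∉A | yes y∈A-x = ⊥-elim (y∉A (p─q⊆p A _ y∈A-x))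

count≡∣A∣ : ∀ {n} (A : Subset n) xs → Unique xs → (∀ x → x ∈ A → x ∈ₗ xs) → count A xs ≡ ∣ A ∣
count≡∣A∣ {n} A [] _ A⊆[] = sym (trans (cong ∣_∣ (Empty-unique (λ { (x , x∈A) → noMember (A⊆[] x x∈A) }))) (∣⊥∣≡0 n))
  where
  noMember : ∀ {x} → ¬ (x ∈ₗ [])
  noMember ()
count≡∣A∣ A (x ∷ xs) (x∉xs ∷ xs-unique) A⊆x∷xs with x ∈? A
... | yes x∈A = begin
  suc (count A xs)        ≡⟨ cong suc (count-remove A xs (λ x∈xs → All.lookup x∉xs x∈xs refl)) ⟩
  suc (count (A - x) xs)  ≡⟨ cong suc (count≡∣A∣ (A - x) xs xs-unique A-x⊆xs) ⟩
  suc ∣ A - x ∣           ≡⟨ sym (∣p∣≡1+∣p-x∣ x∈A) ⟩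
  ∣ A ∣                   ∎
  where
  open ≡-Reasoning
  A-x⊆xs : ∀ y → y ∈ A - x → y ∈ₗ xs
  A-x⊆xs y y∈A-x with A⊆x∷xs y (p─q⊆p A _ y∈A-x)
  ... | Any.here refl = ⊥-elim (x∉p-x y∈A-x)
  ... | Any.there y∈xs = y∈xs
... | no x∉A = count≡∣A∣ A xs xs-unique A⊆xs
  where
  A⊆xs : ∀ y → y ∈ A → y ∈ₗ xs
  A⊆xs y y∈A with A⊆x∷xs y y∈A
  ... | Any.here refl = ⊥-elim (x∉A y∈A)
  ... | Any.there y∈xs = y∈xs

module _ {n : ℕ} where

  leaf-of-child : ∀ {ts : List (Tree n)} {c x} → c ∈ₗ ts → x ∈ₗ leaves c → x ∈ₗ leavesL ts
  leaf-of-child (Any.here refl) x∈c = ∈-++⁺ˡ x∈c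
  leaf-of-child {t ∷ _} (Any.there c∈ts) x∈c = ∈-++⁺ʳ (leaves t) (leaf-of-child c∈ts x∈c)

  leaf-of-children : ∀ {T : Tree n} {v x} → v ∈ₗ children T → x ∈ₗ leaves v → x ∈ₗ leaves T
  leaf-of-children {node _} = leaf-of-child

  leaf-of-subtree : ∀ {t : Tree n} (p : Pos t) {x} → x ∈ₗ leaves (subtreeAt p) → x ∈ₗ leaves t
  leaf-of-subtree here x∈p = x∈p
  leaf-of-subtree (down c∈ts p) x∈p = leaf-of-child c∈ts (leaf-of-subtree p x∈p)

  private
    unique-++ˡ : ∀ (xs : List (Fin n)) {ys} → Unique (xs ++ ys) → Unique xs
    unique-++ˡ [] _ = []
    unique-++ˡ (_ ∷ xs) (x∉ ∷ u) = AllP.++⁻ˡ xs x∉ ∷ unique-++ˡ xs u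

    unique-++ʳ : ∀ (xs : List (Fin n)) {ys} → Unique (xs ++ ys) → Unique ys
    unique-++ʳ [] u = u
    unique-++ʳ (_ ∷ xs) (_ ∷ u) = unique-++ʳ xs u

    unique-child : ∀ {ts : List (Tree n)} {c} → c ∈ₗ ts → Unique (leavesL ts) → Unique (leaves c)
    unique-child {c ∷ _} (Any.here refl) u = unique-++ˡ (leaves c) u
    unique-child {t ∷ _} (Any.there c∈ts) u = unique-child c∈ts (unique-++ʳ (leaves t) u)

  unique-subtree : ∀ {t : Tree n} (p : Pos t) → Unique (leaves t) → Unique (leaves (subtreeAt p))
  unique-subtree here u = u
  unique-subtree (down c∈ts p) u = unique-subtree p (unique-child c∈ts u)

module Counters {n : ℕ} (A : Subset n) where

  open Counting A using (count≤length; count≡length⇔⊆; count≡0⇔disjoint)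

  Full : Tree n → Set
  Full v = ∀ x → x ∈ₗ leaves v → x ∈ A

  Avoiding : Tree n → Set
  Avoiding v = ∀ x → x ∈ₗ leaves v → x ∉ A

  Monochromatic : Tree n → Set
  Monochromatic v = Avoiding v ⊎ Full v

  -- the condition on the children of w in the definition of compatibility
  MonochromaticChildren : Tree n → Set
  MonochromaticChildren w = ∀ v → v ∈ₗ children w → Monochromatic v

  full⇒monochromaticChildren : ∀ w → Full w → MonochromaticChildren w
  full⇒monochromaticChildren w full v v∈w = inj₂ (λ x x∈v → full x (leaf-of-children {T = w} v∈w x∈v))

  contribution : Tree n → ℕ
  contribution w with counter A w ≟ length (leaves w)
  ... | yes _ = counter A w
  ... | no _ = 0

  counterL≡sum : ∀ ts → counterL A ts ≡ sum (map contribution ts)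
  counterL≡sum [] = refl
  counterL≡sum (w ∷ ws) with counter A w ≟ length (leaves w)
  ... | yes _ = cong (counter A w +_) (counterL≡sum ws)
  ... | no _ = counterL≡sum ws

  countL≡sum : ∀ ts → count A (leavesL ts) ≡ sum (map (count A ∘ leaves) ts)
  countL≡sum [] = refl
  countL≡sum (w ∷ ws) = trans (count-++ A (leaves w) (leavesL ws)) (cong (count A (leaves w) +_) (countL≡sum ws))

  mutual
    counter≤count : ∀ t → counter A t ≤ count A (leaves t)
    counter≤count (leaf x) with x ∈? A
    ... | yes _ = ≤-refl
    ... | no _ = z≤n
    counter≤count (node ts) = begin
      counterL A ts                       ≡⟨ counterL≡sum ts ⟩
      sum (map contribution ts)           ≤⟨ sum-map-mono contribution (count A ∘ leaves) (contributions≤count ts) ⟩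
      sum (map (count A ∘ leaves) ts)     ≡⟨ countL≡sum ts ⟨
      count A (leavesL ts)                ∎
      where open ≤-Reasoning

    contributions≤count : ∀ ts → All (λ w → contribution w ≤ count A (leaves w)) ts
    contributions≤count [] = []
    contributions≤count (w ∷ ws) = contribution≤count w ∷ contributions≤count ws

    contribution≤count : ∀ w → contribution w ≤ count A (leaves w)
    contribution≤count w with counter A w ≟ length (leaves w)
    ... | yes _ = counter≤count w
    ... | no _ = z≤n

  mutual
    full⇒counter≡length : ∀ t → Full t → counter A t ≡ length (leaves t)
    full⇒counter≡length (leaf x) full with x ∈? A
    ... | yes _ = refl
    ... | no x∉A = ⊥-elim (x∉A (full x (Any.here refl)))
    full⇒counter≡length (node ts) full = fullL⇒counterL≡length ts full

    fullL⇒counterL≡length : ∀ ts → (∀ x → x ∈ₗ leavesL ts → x ∈ A) → counterL A ts ≡ length (leavesL ts)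
    fullL⇒counterL≡length [] _ = refl
    fullL⇒counterL≡length (w ∷ ws) full with counter A w ≟ length (leaves w)
    ... | yes w-full = trans
      (cong₂ _+_ w-full (fullL⇒counterL≡length ws (λ x → full x ∘ ∈-++⁺ʳ (leaves w))))
      (sym (length-++ (leaves w)))
    ... | no w-not-full = ⊥-elim (w-not-full (full⇒counter≡length w (λ x → full x ∘ ∈-++⁺ˡ)))

  counter≡length⇔full : ∀ t → counter A t ≡ length (leaves t) ⇔ Full t
  counter≡length⇔full t = mk⇔ counter≡length⇒full (full⇒counter≡length t)
    where
    counter≡length⇒full : counter A t ≡ length (leaves t) → Full t
    counter≡length⇒full eq = to (count≡length⇔⊆ (leaves t))
      (≤-antisym (count≤length (leaves t)) (subst (_≤ count A (leaves t)) eq (counter≤count t)))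

  contribution≡count⇔monochromatic : ∀ w → contribution w ≡ count A (leaves w) ⇔ Monochromatic w
  contribution≡count⇔monochromatic w with counter A w ≟ length (leaves w)
  ... | yes counter≡length = mk⇔ (λ _ → inj₂ full) (λ _ → trans counter≡length (sym (from (count≡length⇔⊆ (leaves w)) full)))
    where
    full : Full w
    full = to (counter≡length⇔full w) counter≡length
  ... | no counter≢length = mk⇔ (λ 0≡count → inj₁ (to (count≡0⇔disjoint (leaves w)) (sym 0≡count))) monochromatic⇒0≡count
    where
    monochromatic⇒0≡count : Monochromatic w → 0 ≡ count A (leaves w)
    monochromatic⇒0≡count (inj₁ avoiding) = sym (from (count≡0⇔disjoint (leaves w)) avoiding)
    monochromatic⇒0≡count (inj₂ full) = ⊥-elim (counter≢length (from (counter≡length⇔full w) full))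

  counter≡count⇔monochromaticChildren : ∀ w → counter A w ≡ count A (leaves w) ⇔ MonochromaticChildren w
  counter≡count⇔monochromaticChildren (leaf x) = mk⇔ (λ _ _ ()) (λ _ → leaf-counter)
    where
    leaf-counter : counter A (leaf x) ≡ count A (x ∷ [])
    leaf-counter with x ∈? A
    ... | yes _ = refl
    ... | no _ = refl
  counter≡count⇔monochromaticChildren (node ts) = mk⇔
    (λ eq v v∈ts → to (contribution≡count⇔monochromatic v) (All.lookup (to sums-agree⇔ (rewrite-sums eq)) v∈ts))
    (λ mono → unrewrite-sums (from sums-agree⇔ (All.tabulate (λ {w} → from (contribution≡count⇔monochromatic w) ∘ mono w))))
    where
    sums-agree⇔ : sum (map contribution ts) ≡ sum (map (count A ∘ leaves) ts) ⇔
                  All (λ w → contribution w ≡ count A (leaves w)) ts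
    sums-agree⇔ = sum-map-≡⇔ contribution (count A ∘ leaves) (contributions≤count ts)
    rewrite-sums : counterL A ts ≡ count A (leavesL ts) → sum (map contribution ts) ≡ sum (map (count A ∘ leaves) ts)
    rewrite-sums eq = trans (sym (counterL≡sum ts)) (trans eq (countL≡sum ts))
    unrewrite-sums : sum (map contribution ts) ≡ sum (map (count A ∘ leaves) ts) → counterL A ts ≡ count A (leavesL ts)
    unrewrite-sums eq = trans (counterL≡sum ts) (trans eq (sym (countL≡sum ts)))

  -- Compatibility at an ancestor descends to any vertex that meets A: if w is a
  -- proper ancestor of p, the child of w above p meets A, hence is full, hence so is p.
  descend : ∀ {t : Tree n} {p w : Pos t} → p ≼ w →
    (Σ (Fin n) λ y → y ∈ A × y ∈ₗ leaves (subtreeAt p)) →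
    MonochromaticChildren (subtreeAt w) → MonochromaticChildren (subtreeAt p)
  descend {p = here} root _ mono = mono
  descend {p = down c∈ts p} root (y , y∈A , y∈p) mono with mono _ c∈ts
  ... | inj₁ avoiding = ⊥-elim (avoiding y (leaf-of-subtree p y∈p) y∈A)
  ... | inj₂ full = full⇒monochromaticChildren (subtreeAt p) (λ x → full x ∘ leaf-of-subtree p)
  descend (step p≼w) meets mono = descend p≼w meets mono

mainTheorem2 : ∀ {n : ℕ} (t : Tree n) → LeafLabelled t →
    (A : Subset n) → Nonempty A →
    (z : Pos t) → IsLCA A z →
    (Compatible A t ⇔ (counter A (subtreeAt z) ≡ ∣ A ∣))
mainTheorem2 t (_ , unique , _) A (y , y∈A) z (A⊆z , least) = mk⇔ compatible⇒counter counter⇒compatible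
  where
  open Counters A
  Z : Tree _
  Z = subtreeAt z
  -- by distinctness of the labels, z' sees every element of A exactly once
  count≡∣A∣-at-z : count A (leaves Z) ≡ ∣ A ∣
  count≡∣A∣-at-z = count≡∣A∣ A (leaves Z) (unique-subtree z unique) A⊆z
  meets : Σ (Fin _) λ x → x ∈ A × x ∈ₗ leaves Z
  meets = y , y∈A , A⊆z y y∈A
  -- a compatibility witness w is an ancestor of z', so z' inherits monochromatic children
  compatible⇒counter : Compatible A t → counter A Z ≡ ∣ A ∣
  compatible⇒counter (w , A⊆w , mono) = trans
    (from (counter≡count⇔monochromaticChildren Z) (descend (least w A⊆w) meets mono))
    count≡∣A∣-at-z
  counter⇒compatible : counter A Z ≡ ∣ A ∣ → Compatible A t
  counter⇒compatible counter≡∣A∣ = z , A⊆z ,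
    to (counter≡count⇔monochromaticChildren Z) (trans counter≡∣A∣ (sym count≡∣A∣-at-z))
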